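{- Let $\mathbb{L}$ be a (not necessarily commutative) ring with unity. Let $V$ be a finite set and $n=|V|$. For each $s\in V$, let $x_s\in\mathbb{L}$. Let $X,Y\in\mathbb{L}$ be such that $X+Y$ lies in the center of $\mathbb{L}$. Then \[ \sum_{S\subseteq V}X\Big(X+\sum_{s\in S}x_s\Big)^{|S|-1}\Big(Y-\sum_{s\in S}x_s\Big)^{n-|S|-1}\Big(Y-\sum_{s\in V}x_s\Big)=\Big(X+Y-\sum_{s\in V}x_s\Big)(X+Y)^{n-1}, \] with the following interpretations: the product $X\big(X+\sum_{s\in S}x_s\big)^{|S|-1}$ is interpreted as $1$ when $S=\varnothing$; the product $\big(Y-\sum_{s\in S}x_s\big)^{n-|S|-1}\big(Y-\sum_{s\in V}x_s\big)$ is interpreted as $1$ when $|S|=n$; and the product $\big(X+Y-\sum_{s\in V}x_s\big)(X+Y)^{n-1}$ is interpreted as $1$ when $n=0$. -}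

module Defs where

open import Level using (Level)
open import Data.Nat using (ℕ; zero; suc; _∸_)
open import Data.Fin using (Fin)
open import Data.Vec using (_∷_; []; lookup)
open import Data.Fin.Subset using (Subset; Side; inside; outside; ∣_∣; ⊤)
open import Algebra.Bundles using (Ring)
import Algebra.Bundles
import Algebra.Definitions.RawSemiring as RS

module _ {c ℓ : Level} (R : Ring c ℓ) where
  open Ring R
  open RS (Algebra.Bundles.Semiring.rawSemiring semiring) using (_^_; sum)

  Central : Carrier → Set (c Level.⊔ ℓ)
  Central z = ∀ w → (z * w) ≈ (w * z)

  sumSubsets : ∀ n → (Subset n → Carrier) → Carrier
  sumSubsets zero    f = f []
  sumSubsets (suc n) f = sumSubsets n (λ S → f (outside ∷ S)) + sumSubsets n (λ S → f (inside ∷ S))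

  σ : ∀ {n} → (Fin n → Carrier) → Subset n → Carrier
  σ x S = sum (λ i → sel (lookup S i) i)
    where
    sel : Side → Fin _ → Carrier
    sel inside  i = x i
    sel outside i = 0#

  leftFactor : ∀ {n} → (Fin n → Carrier) → Carrier → Subset n → Carrier
  leftFactor x X S = go ∣ S ∣
    where
    go : ℕ → Carrier
    go zero    = 1#
    go (suc k) = X * ((X + σ x S) ^ k)

  rightFactor : ∀ n → (Fin n → Carrier) → Carrier → Subset n → Carrier
  rightFactor n x Y S = go (n ∸ ∣ S ∣)
    where
    go : ℕ → Carrier
    go zero    = 1#
    go (suc k) = ((Y - σ x S) ^ k) * (Y - σ x ⊤)

  rhs : ∀ n → (Fin n → Carrier) → Carrier → Carrier → Carrier
  rhs zero    x X Y = 1#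
  rhs (suc k) x X Y = ((X + Y) - σ x ⊤) * ((X + Y) ^ k)

  lhs : ∀ n → (Fin n → Carrier) → Carrier → Carrier → Carrier
  lhs n x X Y = sumSubsets n (λ S → leftFactor x X S * rightFactor n x Y S)

{-# OPTIONS --safe #-}

-- Put z = X + Y, a_S = X + σ_S and b_S = Y - σ_S, so that a_S + b_S = z is central. Besides the
-- left-hand side, consider the sums over S ⊆ V of the power terms a_S^|S| b_S^|V∖S| (P) and of
-- the lead terms X a_S^(|S|-1) b_S^|V∖S| (G). Writing a_S = X + σ_S in one factor and regrouping
-- Σ_S σ_S (…) as Σ_s x_s Σ_{S ∋ s} (…) gives P = G + Σ_s x_s P_{V∖s}(X + x_s, Y - x_s).
-- Removing one element u of V and using b_S^(m+1) = (z - a_S) b_S^m gives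
-- G = z G_{V∖u}(X, Y) + X (P_{V∖u}(X + x_u, Y - x_u) - P_{V∖u}(X, Y)).
-- A simultaneous induction on |V| therefore shows that P depends only on X + Y and that G = z^|V|.
-- Finally, writing the last factor of each term of G via b_S = (Y - σ_V) + σ_{V∖S} and regrouping
-- over s ∉ S gives G = lhs + Σ_s G_{V∖s}(X, Y) x_s = lhs + z^(n-1) σ_V, so lhs = (z - σ_V) z^(n-1).

module Submission where

open import Defs
open import Level using (Level)
open import Data.Nat using (ℕ; zero; suc; pred; _∸_)
open import Data.Fin using (Fin; zero; suc)
open import Data.Bool using (not)
open import Data.Product using (Σ; _,_; proj₁)
open import Function using (_∘_; flip)
open import Data.Vec using (_∷_; []; lookup; insertAt)
open import Data.Vec.Properties
  using (insertAt-lookup; insertAt-punchIn; map-insertAt; lookup-map; lookup-replicate)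
open import Data.Vec.Functional using (removeAt)
open import Data.Fin.Subset using (Subset; Side; inside; outside; ∣_∣; ⊤; ∁)
open import Data.Fin.Subset.Properties using (∣∁p∣≡n∸∣p∣)
open import Algebra.Bundles using (Ring)
import Algebra.Definitions
import Algebra.Properties.CommutativeSemigroup as CommutativeSemigroupProperties
import Algebra.Properties.Ring as RingProperties
import Algebra.Properties.Semiring.Exp as ExpProperties
import Algebra.Properties.Semiring.Sum as SumProperties
import Relation.Binary.Reasoning.Setoid as SetoidReasoning
open import Relation.Binary.PropositionalEquality as ≡ using (_≡_)

module AbelIdentity {c ℓ : Level} (R : Ring c ℓ) where
  open Ring R hiding (zero)
  open Algebra.Definitions _≈_ using (Congruent₁)
  open CommutativeSemigroupProperties +-commutativeSemigroup using (interchange; xy∙z≈xz∙y)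
  open RingProperties R using (-‿+-comm; +-cancelʳ)
  open ExpProperties semiring using (_^_; ^-congˡ)
  open SumProperties semiring
    using (sum; sum-remove; ∑-distrib-+; *-distribˡ-sum; *-distribʳ-sum; sum-cong-≋; sum-cong-≗)
  open SetoidReasoning setoid

  -- Ring arithmetic

  rebalance : ∀ {X Y z} u → X + Y ≈ z → (X + u) + (Y - u) ≈ z
  rebalance {X} {Y} {z} u X+Y≈z = begin
    (X + u) + (Y - u)  ≈⟨ interchange X u Y (- u) ⟩
    (X + Y) + (u - u)  ≈⟨ +-cong X+Y≈z (-‿inverseʳ u) ⟩
    z + 0#             ≈⟨ +-identityʳ z ⟩
    z                  ∎

  [z-s]w+ws≈zw : ∀ z s w → s * w ≈ w * s → (z - s) * w + w * s ≈ z * w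
  [z-s]w+ws≈zw z s w sw≈ws = begin
    (z - s) * w + w * s        ≈⟨ +-cong (distribʳ w z (- s)) (sym sw≈ws) ⟩
    (z * w + - s * w) + s * w  ≈⟨ +-assoc (z * w) (- s * w) (s * w) ⟩
    z * w + (- s * w + s * w)  ≈⟨ +-congˡ (distribʳ w (- s) s) ⟨
    z * w + (- s + s) * w      ≈⟨ +-congˡ (*-congʳ (-‿inverseˡ s)) ⟩
    z * w + 0# * w             ≈⟨ +-congˡ (zeroˡ w) ⟩
    z * w + 0#                 ≈⟨ +-identityʳ (z * w) ⟩
    z * w                      ∎

  commute-^ : ∀ {a b} → a * b ≈ b * a → ∀ k → a * b ^ k ≈ b ^ k * a
  commute-^ {a} {b} ab≈ba zero    = trans (*-identityʳ a) (sym (*-identityˡ a))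
  commute-^ {a} {b} ab≈ba (suc k) = begin
    a * (b * b ^ k)  ≈⟨ *-assoc a b (b ^ k) ⟨
    (a * b) * b ^ k  ≈⟨ *-congʳ ab≈ba ⟩
    (b * a) * b ^ k  ≈⟨ *-assoc b a (b ^ k) ⟩
    b * (a * b ^ k)  ≈⟨ *-congˡ (commute-^ ab≈ba k) ⟩
    b * (b ^ k * a)  ≈⟨ *-assoc b (b ^ k) a ⟨
    (b * b ^ k) * a  ∎

  ^-central : ∀ {z} → Central R z → ∀ k → Central R (z ^ k)
  ^-central z-central k w = sym (commute-^ (sym (z-central w)) k)

  lead : Carrier → ℕ → Carrier → Carrier
  lead X zero    a = 1#
  lead X (suc k) a = X * a ^ k

  trail : Carrier → ℕ → Carrier → Carrier
  trail B zero    b = 1#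
  trail B (suc l) b = b ^ l * B

  lead-cong : ∀ X k → Congruent₁ (lead X k)
  lead-cong X zero    a≈a′ = refl
  lead-cong X (suc k) a≈a′ = *-congˡ (^-congˡ k a≈a′)

  lead-*ʳ : ∀ X s k → (k ≡ 0 → s ≈ 0#) → lead X k (X + s) * (X + s) ≈ X * (X + s) ^ k
  lead-*ʳ X s zero s≈0 = begin
    1# * (X + s)  ≈⟨ *-identityˡ (X + s) ⟩
    X + s         ≈⟨ +-congˡ (s≈0 ≡.refl) ⟩
    X + 0#        ≈⟨ +-identityʳ X ⟩
    X             ≈⟨ *-identityʳ X ⟨
    X * 1#        ∎
  lead-*ʳ X s (suc k) _ = begin
    (X * a ^ k) * a  ≈⟨ *-assoc X (a ^ k) a ⟩
    X * (a ^ k * a)  ≈⟨ *-congˡ (commute-^ refl k) ⟨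
    X * (a * a ^ k)  ∎
    where a = X + s

  ^-split-lead : ∀ X s k → (k ≡ 0 → s ≈ 0#) →
                 (X + s) ^ k ≈ lead X k (X + s) + s * (X + s) ^ pred k
  ^-split-lead X s zero s≈0 = begin
    1#             ≈⟨ +-identityʳ 1# ⟨
    1# + 0#        ≈⟨ +-congˡ (zeroˡ 1#) ⟨
    1# + 0# * 1#   ≈⟨ +-congˡ (*-congʳ (s≈0 ≡.refl)) ⟨
    1# + s * 1#    ∎
  ^-split-lead X s (suc k) _ = distribʳ ((X + s) ^ k) X s

  ^-split-trail : ∀ B t l {b} → b ≈ B + t → (l ≡ 0 → t ≈ 0#) →
                  b ^ l ≈ trail B l b + b ^ pred l * t
  ^-split-trail B t zero _ t≈0 = begin
    1#             ≈⟨ +-identityʳ 1# ⟨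
    1# + 0#        ≈⟨ +-congˡ (zeroʳ 1#) ⟨
    1# + 1# * 0#   ≈⟨ +-congˡ (*-congˡ (t≈0 ≡.refl)) ⟨
    1# + 1# * t    ∎
  ^-split-trail B t (suc l) {b} b≈B+t _ = begin
    b * b ^ l              ≈⟨ commute-^ refl l ⟩
    b ^ l * b              ≈⟨ *-congˡ b≈B+t ⟩
    b ^ l * (B + t)        ≈⟨ distribˡ (b ^ l) B t ⟩
    b ^ l * B + b ^ l * t  ∎

  lead-step : ∀ {z} → Central R z → ∀ X s k l {b} → (k ≡ 0 → s ≈ 0#) → (X + s) + b ≈ z →
              lead X k (X + s) * b ^ suc l + X * ((X + s) ^ k * b ^ l) ≈ z * (lead X k (X + s) * b ^ l)
  lead-step {z} z-central X s k l {b} s≈0 a+b≈z = begin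
    L * (b * b ^ l) + X * (a ^ k * b ^ l)  ≈⟨ +-congˡ (*-assoc X (a ^ k) (b ^ l)) ⟨
    L * (b * b ^ l) + (X * a ^ k) * b ^ l  ≈⟨ +-congˡ (*-congʳ (lead-*ʳ X s k s≈0)) ⟨
    L * (b * b ^ l) + (L * a) * b ^ l      ≈⟨ +-congˡ (*-assoc L a (b ^ l)) ⟩
    L * (b * b ^ l) + L * (a * b ^ l)      ≈⟨ distribˡ L (b * b ^ l) (a * b ^ l) ⟨
    L * (b * b ^ l + a * b ^ l)            ≈⟨ *-congˡ (distribʳ (b ^ l) b a) ⟨
    L * ((b + a) * b ^ l)                  ≈⟨ *-congˡ (*-congʳ (trans (+-comm b a) a+b≈z)) ⟩
    L * (z * b ^ l)                        ≈⟨ *-assoc L z (b ^ l) ⟨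
    (L * z) * b ^ l                        ≈⟨ *-congʳ (z-central L) ⟨
    (z * L) * b ^ l                        ≈⟨ *-assoc z L (b ^ l) ⟩
    z * (L * b ^ l)                        ∎
    where
    a = X + s
    L = lead X k a

  -- Sums over subsets

  select : Side → Carrier → Carrier
  select inside  a = a
  select outside a = 0#

  σ≡sum-select : ∀ {n} (x : Fin n → Carrier) (S : Subset n) →
                 σ R x S ≡ sum (λ i → select (lookup S i) (x i))
  σ≡sum-select {n} x S = sum-cong-≗ summand≗select
    where
    -- The summand of σ is local to its definition, so it is named here by unification.
    summand : Σ (Fin n → Carrier) (λ f → σ R x S ≡ sum f)
    summand = _ , ≡.refl

    summand≗select : ∀ i → proj₁ summand i ≡ select (lookup S i) (x i)
    summand≗select i with lookup S i
    ... | inside  = ≡.refl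
    ... | outside = ≡.refl

  σ∁≡sum-select-not : ∀ {n} (x : Fin n → Carrier) (S : Subset n) →
                      σ R x (∁ S) ≡ sum (λ i → select (not (lookup S i)) (x i))
  σ∁≡sum-select-not x S = ≡.trans (σ≡sum-select x (∁ S))
    (sum-cong-≗ (λ i → ≡.cong (λ w → select w (x i)) (lookup-map i not S)))

  σ-insertAt : ∀ {n} (x : Fin (suc n) → Carrier) (S : Subset n) i v →
               σ R x (insertAt S i v) ≈ select v (x i) + σ R (removeAt x i) S
  σ-insertAt x S i v = begin
    σ R x S⁺
      ≡⟨ σ≡sum-select x S⁺ ⟩
    sum t
      ≈⟨ sum-remove {i = i} t ⟩
    t i + sum (removeAt t i)
      ≡⟨ ≡.cong₂ _+_ (≡.cong (λ w → select w (x i)) (insertAt-lookup S i v))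
                     (sum-cong-≗ λ j → ≡.cong (λ w → select w (removeAt x i j)) (insertAt-punchIn S i v j)) ⟩
    select v (x i) + sum (λ j → select (lookup S j) (removeAt x i j))
      ≡⟨ ≡.cong (select v (x i) +_) (σ≡sum-select (removeAt x i) S) ⟨
    select v (x i) + σ R (removeAt x i) S
      ∎
    where
    S⁺ = insertAt S i v
    t = λ j → select (lookup S⁺ j) (x j)

  σ-∁ : ∀ {n} (x : Fin n → Carrier) (S : Subset n) → σ R x S + σ R x (∁ S) ≈ sum x
  σ-∁ x S = begin
    σ R x S + σ R x (∁ S)
      ≡⟨ ≡.cong₂ _+_ (σ≡sum-select x S) (σ∁≡sum-select-not x S) ⟩
    sum inS + sum inS∁
      ≈⟨ ∑-distrib-+ inS inS∁ ⟨
    sum (λ i → inS i + inS∁ i)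
      ≈⟨ sum-cong-≋ (λ i → select-partition (lookup S i) (x i)) ⟩
    sum x
      ∎
    where
    inS = λ i → select (lookup S i) (x i)
    inS∁ = λ i → select (not (lookup S i)) (x i)

    select-partition : ∀ v a → select v a + select (not v) a ≈ a
    select-partition inside  a = +-identityʳ a
    select-partition outside a = +-identityˡ a

  σ-⊤ : ∀ {n} (x : Fin n → Carrier) → σ R x ⊤ ≈ sum x
  σ-⊤ x = reflexive (≡.trans (σ≡sum-select x ⊤)
    (sum-cong-≗ (λ i → ≡.cong (λ w → select w (x i)) (lookup-replicate i inside))))

  ∣S∣≡0⇒σ≈0 : ∀ {n} (x : Fin n → Carrier) (S : Subset n) → ∣ S ∣ ≡ 0 → σ R x S ≈ 0#
  ∣S∣≡0⇒σ≈0 x []            _     = refl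
  ∣S∣≡0⇒σ≈0 x (outside ∷ S) ∣S∣≡0 = trans (σ-insertAt x S zero outside)
    (trans (+-identityˡ _) (∣S∣≡0⇒σ≈0 (removeAt x zero) S ∣S∣≡0))

  ∣insertAt-inside∣ : ∀ {n} (S : Subset n) i → ∣ insertAt S i inside ∣ ≡ suc ∣ S ∣
  ∣insertAt-inside∣ S             zero    = ≡.refl
  ∣insertAt-inside∣ (inside ∷ S)  (suc i) = ≡.cong suc (∣insertAt-inside∣ S i)
  ∣insertAt-inside∣ (outside ∷ S) (suc i) = ∣insertAt-inside∣ S i

  ∣insertAt-outside∣ : ∀ {n} (S : Subset n) i → ∣ insertAt S i outside ∣ ≡ ∣ S ∣
  ∣insertAt-outside∣ S             zero    = ≡.refl
  ∣insertAt-outside∣ (inside ∷ S)  (suc i) = ≡.cong suc (∣insertAt-outside∣ S i)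
  ∣insertAt-outside∣ (outside ∷ S) (suc i) = ∣insertAt-outside∣ S i

  sumSubsets-cong : ∀ n {f g : Subset n → Carrier} → (∀ S → f S ≈ g S) →
                    sumSubsets R n f ≈ sumSubsets R n g
  sumSubsets-cong zero    f≈g = f≈g []
  sumSubsets-cong (suc n) f≈g =
    +-cong (sumSubsets-cong n (λ S → f≈g (outside ∷ S))) (sumSubsets-cong n (λ S → f≈g (inside ∷ S)))

  sumSubsets-+ : ∀ n (f g : Subset n → Carrier) →
                 sumSubsets R n (λ S → f S + g S) ≈ sumSubsets R n f + sumSubsets R n g
  sumSubsets-+ zero    f g = refl
  sumSubsets-+ (suc n) f g = trans
    (+-cong (sumSubsets-+ n (λ S → f (outside ∷ S)) (λ S → g (outside ∷ S)))
            (sumSubsets-+ n (λ S → f (inside ∷ S)) (λ S → g (inside ∷ S))))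
    (interchange _ _ _ _)

  sumSubsets-*ˡ : ∀ n w (f : Subset n → Carrier) →
                  sumSubsets R n (λ S → w * f S) ≈ w * sumSubsets R n f
  sumSubsets-*ˡ zero    w f = refl
  sumSubsets-*ˡ (suc n) w f = trans
    (+-cong (sumSubsets-*ˡ n w (λ S → f (outside ∷ S))) (sumSubsets-*ˡ n w (λ S → f (inside ∷ S))))
    (sym (distribˡ w _ _))

  sumSubsets-*ʳ : ∀ n w (f : Subset n → Carrier) →
                  sumSubsets R n (λ S → f S * w) ≈ sumSubsets R n f * w
  sumSubsets-*ʳ zero    w f = refl
  sumSubsets-*ʳ (suc n) w f = trans
    (+-cong (sumSubsets-*ʳ n w (λ S → f (outside ∷ S))) (sumSubsets-*ʳ n w (λ S → f (inside ∷ S))))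
    (sym (distribʳ w _ _))

  sumSubsets-sum : ∀ n {m} (f : Fin m → Subset n → Carrier) →
                   sumSubsets R n (λ S → sum (λ i → f i S)) ≈ sum (λ i → sumSubsets R n (f i))
  sumSubsets-sum zero    f = refl
  sumSubsets-sum (suc n) f = trans
    (+-cong (sumSubsets-sum n (λ i S → f i (outside ∷ S))) (sumSubsets-sum n (λ i S → f i (inside ∷ S))))
    (sym (∑-distrib-+ (λ i → sumSubsets R n (λ S → f i (outside ∷ S)))
                      (λ i → sumSubsets R n (λ S → f i (inside ∷ S)))))

  sumSubsets-insertAt : ∀ n i (f : Subset (suc n) → Carrier) →
    sumSubsets R (suc n) f
      ≈ sumSubsets R n (λ S → f (insertAt S i outside)) + sumSubsets R n (λ S → f (insertAt S i inside))
  sumSubsets-insertAt n       zero    f = refl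
  sumSubsets-insertAt (suc n) (suc i) f = trans
    (+-cong (sumSubsets-insertAt n i (λ S → f (outside ∷ S)))
            (sumSubsets-insertAt n i (λ S → f (inside ∷ S))))
    (interchange _ _ _ _)

  sumSubsets-sum-lookup : ∀ n (F : Fin (suc n) → Side → Subset (suc n) → Carrier) →
    sumSubsets R (suc n) (λ S → sum (λ i → F i (lookup S i) S))
      ≈ sum (λ i → sumSubsets R n (λ S → F i outside (insertAt S i outside))
                 + sumSubsets R n (λ S → F i inside (insertAt S i inside)))
  sumSubsets-sum-lookup n F = trans (sumSubsets-sum (suc n) (λ i S → F i (lookup S i) S))
    (sum-cong-≋ {suc n} λ i → trans (sumSubsets-insertAt n i (λ S → F i (lookup S i) S))
      (+-cong (sumSubsets-cong n (λ S → at-inserted i S outside))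
              (sumSubsets-cong n (λ S → at-inserted i S inside))))
    where
    at-inserted : ∀ i S v → F i (lookup (insertAt S i v) i) (insertAt S i v) ≈ F i v (insertAt S i v)
    at-inserted i S v = reflexive (≡.cong (λ w → F i w (insertAt S i v)) (insertAt-lookup S i v))

  sumSubsets-σ-* : ∀ n (x : Fin (suc n) → Carrier) (g : Subset (suc n) → Carrier) →
    sumSubsets R (suc n) (λ S → σ R x S * g S)
      ≈ sum (λ i → x i * sumSubsets R n (λ S → g (insertAt S i inside)))
  sumSubsets-σ-* n x g = begin
    sumSubsets R (suc n) (λ S → σ R x S * g S)
      ≈⟨ sumSubsets-cong (suc n) (λ S → trans (*-congʳ (reflexive (σ≡sum-select x S)))
                                              (*-distribʳ-sum (g S) (λ i → select (lookup S i) (x i)))) ⟩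
    sumSubsets R (suc n) (λ S → sum (λ i → select (lookup S i) (x i) * g S))
      ≈⟨ sumSubsets-sum-lookup n (λ i v S → select v (x i) * g S) ⟩
    sum (λ i → sumSubsets R n (λ S → 0# * g⁻ i S) + sumSubsets R n (λ S → x i * g⁺ i S))
      ≈⟨ sum-cong-≋ {suc n} (λ i → +-cong (trans (sumSubsets-*ˡ n 0# (g⁻ i)) (zeroˡ _))
                                          (sumSubsets-*ˡ n (x i) (g⁺ i))) ⟩
    sum (λ i → 0# + x i * sumSubsets R n (g⁺ i))
      ≈⟨ sum-cong-≋ {suc n} (λ i → +-identityˡ (x i * sumSubsets R n (g⁺ i))) ⟩
    sum (λ i → x i * sumSubsets R n (g⁺ i))
      ∎
    where
    g⁻ g⁺ : Fin (suc n) → Subset n → Carrier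
    g⁻ i S = g (insertAt S i outside)
    g⁺ i S = g (insertAt S i inside)

  sumSubsets-*-σ∁ : ∀ n (x : Fin (suc n) → Carrier) (g : Subset (suc n) → Carrier) →
    sumSubsets R (suc n) (λ S → g S * σ R x (∁ S))
      ≈ sum (λ i → sumSubsets R n (λ S → g (insertAt S i outside)) * x i)
  sumSubsets-*-σ∁ n x g = begin
    sumSubsets R (suc n) (λ S → g S * σ R x (∁ S))
      ≈⟨ sumSubsets-cong (suc n) (λ S → trans (*-congˡ (reflexive (σ∁≡sum-select-not x S)))
                                              (*-distribˡ-sum (g S) λ i → select (not (lookup S i)) (x i))) ⟩
    sumSubsets R (suc n) (λ S → sum (λ i → g S * select (not (lookup S i)) (x i)))
      ≈⟨ sumSubsets-sum-lookup n (λ i v S → g S * select (not v) (x i)) ⟩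
    sum (λ i → sumSubsets R n (λ S → g⁻ i S * x i) + sumSubsets R n (λ S → g⁺ i S * 0#))
      ≈⟨ sum-cong-≋ {suc n} (λ i → +-cong (sumSubsets-*ʳ n (x i) (g⁻ i))
                                          (trans (sumSubsets-*ʳ n 0# (g⁺ i)) (zeroʳ _))) ⟩
    sum (λ i → sumSubsets R n (g⁻ i) * x i + 0#)
      ≈⟨ sum-cong-≋ {suc n} (λ i → +-identityʳ (sumSubsets R n (g⁻ i) * x i)) ⟩
    sum (λ i → sumSubsets R n (g⁻ i) * x i)
      ∎
    where
    g⁻ g⁺ : Fin (suc n) → Subset n → Carrier
    g⁻ i S = g (insertAt S i outside)
    g⁺ i S = g (insertAt S i inside)

  -- Abel-type sums

  α : ∀ {n} → (Fin n → Carrier) → Carrier → Subset n → Carrier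
  α x X S = X + σ R x S

  β : ∀ {n} → (Fin n → Carrier) → Carrier → Subset n → Carrier
  β x Y S = Y - σ R x S

  α-insertAt-inside : ∀ {n} (x : Fin (suc n) → Carrier) X S i →
                      α x X (insertAt S i inside) ≈ α (removeAt x i) (X + x i) S
  α-insertAt-inside x X S i =
    trans (+-congˡ (σ-insertAt x S i inside)) (sym (+-assoc X (x i) (σ R (removeAt x i) S)))

  β-insertAt-inside : ∀ {n} (x : Fin (suc n) → Carrier) Y S i →
                      β x Y (insertAt S i inside) ≈ β (removeAt x i) (Y - x i) S
  β-insertAt-inside x Y S i = begin
    Y - σ R x (insertAt S i inside)  ≈⟨ +-congˡ (-‿cong (σ-insertAt x S i inside)) ⟩
    Y - (x i + s)                    ≈⟨ +-congˡ (-‿+-comm (x i) s) ⟨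
    Y + (- x i - s)                  ≈⟨ +-assoc Y (- x i) (- s) ⟨
    (Y - x i) - s                    ∎
    where s = σ R (removeAt x i) S

  α-insertAt-outside : ∀ {n} (x : Fin (suc n) → Carrier) X S i →
                       α x X (insertAt S i outside) ≈ α (removeAt x i) X S
  α-insertAt-outside x X S i = +-congˡ (trans (σ-insertAt x S i outside) (+-identityˡ _))

  β-insertAt-outside : ∀ {n} (x : Fin (suc n) → Carrier) Y S i →
                       β x Y (insertAt S i outside) ≈ β (removeAt x i) Y S
  β-insertAt-outside x Y S i = +-congˡ (-‿cong (trans (σ-insertAt x S i outside) (+-identityˡ _)))

  β≈β⊤+σ∁ : ∀ {n} (x : Fin n → Carrier) Y S → β x Y S ≈ β x Y ⊤ + σ R x (∁ S)
  β≈β⊤+σ∁ x Y S = sym (begin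
    (Y - σ R x ⊤) + t      ≈⟨ +-congʳ (+-congˡ (-‿cong (trans (σ-⊤ x) (sym (σ-∁ x S))))) ⟩
    (Y - (s + t)) + t      ≈⟨ +-congʳ (+-congˡ (-‿+-comm s t)) ⟨
    (Y + (- s - t)) + t    ≈⟨ +-assoc Y (- s - t) t ⟩
    Y + ((- s - t) + t)    ≈⟨ +-congˡ (+-assoc (- s) (- t) t) ⟩
    Y + (- s + (- t + t))  ≈⟨ +-congˡ (+-congˡ (-‿inverseˡ t)) ⟩
    Y + (- s + 0#)         ≈⟨ +-congˡ (+-identityʳ (- s)) ⟩
    Y - s                  ∎)
    where
    s = σ R x S
    t = σ R x (∁ S)

  abelTerm : (f g : ℕ → Carrier → Carrier) → ∀ {n} → (Fin n → Carrier) → Carrier → Carrier →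
             Subset n → Carrier
  abelTerm f g x X Y S = f (∣ S ∣) (α x X S) * g (∣ ∁ S ∣) (β x Y S)

  abelSum : (f g : ℕ → Carrier → Carrier) → ∀ n → (Fin n → Carrier) → Carrier → Carrier → Carrier
  abelSum f g n x X Y = sumSubsets R n (abelTerm f g x X Y)

  module _ {f g : ℕ → Carrier → Carrier}
           (f-cong : ∀ k → Congruent₁ (f k)) (g-cong : ∀ l → Congruent₁ (g l)) where

    abelTerm-insertAt-inside : ∀ {n} (x : Fin (suc n) → Carrier) X Y S i →
      abelTerm f g x X Y (insertAt S i inside) ≈ abelTerm (f ∘ suc) g (removeAt x i) (X + x i) (Y - x i) S
    abelTerm-insertAt-inside x X Y S i = begin
      f (∣ S⁺ ∣) (α x X S⁺) * g (∣ ∁ S⁺ ∣) (β x Y S⁺)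
        ≡⟨ ≡.cong₂ (λ k l → f k (α x X S⁺) * g l (β x Y S⁺)) (∣insertAt-inside∣ S i) ∣∁S⁺∣≡∣∁S∣ ⟩
      f (suc ∣ S ∣) (α x X S⁺) * g (∣ ∁ S ∣) (β x Y S⁺)
        ≈⟨ *-cong (f-cong (suc ∣ S ∣) (α-insertAt-inside x X S i))
                  (g-cong (∣ ∁ S ∣) (β-insertAt-inside x Y S i)) ⟩
      abelTerm (f ∘ suc) g (removeAt x i) (X + x i) (Y - x i) S
        ∎
      where
      S⁺ = insertAt S i inside
      ∣∁S⁺∣≡∣∁S∣ : ∣ ∁ S⁺ ∣ ≡ ∣ ∁ S ∣
      ∣∁S⁺∣≡∣∁S∣ = ≡.trans (≡.cong ∣_∣ (map-insertAt not inside S i)) (∣insertAt-outside∣ (∁ S) i)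

    abelTerm-insertAt-outside : ∀ {n} (x : Fin (suc n) → Carrier) X Y S i →
      abelTerm f g x X Y (insertAt S i outside) ≈ abelTerm f (g ∘ suc) (removeAt x i) X Y S
    abelTerm-insertAt-outside x X Y S i = begin
      f (∣ S⁻ ∣) (α x X S⁻) * g (∣ ∁ S⁻ ∣) (β x Y S⁻)
        ≡⟨ ≡.cong₂ (λ k l → f k (α x X S⁻) * g l (β x Y S⁻)) (∣insertAt-outside∣ S i) ∣∁S⁻∣≡1+∣∁S∣ ⟩
      f (∣ S ∣) (α x X S⁻) * g (suc ∣ ∁ S ∣) (β x Y S⁻)
        ≈⟨ *-cong (f-cong (∣ S ∣) (α-insertAt-outside x X S i))
                  (g-cong (suc ∣ ∁ S ∣) (β-insertAt-outside x Y S i)) ⟩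
      abelTerm f (g ∘ suc) (removeAt x i) X Y S
        ∎
      where
      S⁻ = insertAt S i outside
      ∣∁S⁻∣≡1+∣∁S∣ : ∣ ∁ S⁻ ∣ ≡ suc ∣ ∁ S ∣
      ∣∁S⁻∣≡1+∣∁S∣ = ≡.trans (≡.cong ∣_∣ (map-insertAt not outside S i)) (∣insertAt-inside∣ (∁ S) i)

    abelSum-insertAt : ∀ n (x : Fin (suc n) → Carrier) X Y i →
      abelSum f g (suc n) x X Y
        ≈ abelSum f (g ∘ suc) n (removeAt x i) X Y + abelSum (f ∘ suc) g n (removeAt x i) (X + x i) (Y - x i)
    abelSum-insertAt n x X Y i = trans (sumSubsets-insertAt n i (abelTerm f g x X Y))
      (+-cong (sumSubsets-cong n (λ S → abelTerm-insertAt-outside x X Y S i))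
              (sumSubsets-cong n (λ S → abelTerm-insertAt-inside x X Y S i)))

    abelSum-σ : ∀ n (x : Fin (suc n) → Carrier) X Y →
      sumSubsets R (suc n) (λ S → σ R x S * abelTerm f g x X Y S)
        ≈ sum (λ i → x i * abelSum (f ∘ suc) g n (removeAt x i) (X + x i) (Y - x i))
    abelSum-σ n x X Y = trans (sumSubsets-σ-* n x (abelTerm f g x X Y))
      (sum-cong-≋ {suc n} (λ i → *-congˡ {x i}
        (sumSubsets-cong n (λ S → abelTerm-insertAt-inside x X Y S i))))

    abelSum-σ∁ : ∀ n (x : Fin (suc n) → Carrier) X Y →
      sumSubsets R (suc n) (λ S → abelTerm f g x X Y S * σ R x (∁ S))
        ≈ sum (λ i → abelSum f (g ∘ suc) n (removeAt x i) X Y * x i)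
    abelSum-σ∁ n x X Y = trans (sumSubsets-*-σ∁ n x (abelTerm f g x X Y))
      (sum-cong-≋ {suc n} (λ i → *-congʳ {x i}
        (sumSubsets-cong n (λ S → abelTerm-insertAt-outside x X Y S i))))

  powerSum : ∀ n → (Fin n → Carrier) → Carrier → Carrier → Carrier
  powerSum = abelSum (flip _^_) (flip _^_)

  leadSum : ∀ n → (Fin n → Carrier) → Carrier → Carrier → Carrier
  leadSum n x X Y = abelSum (lead X) (flip _^_) n x X Y

  leftFactor≡lead : ∀ {n} (x : Fin n → Carrier) X S → leftFactor R x X S ≡ lead X (∣ S ∣) (α x X S)
  leftFactor≡lead x X S with ∣ S ∣
  ... | zero  = ≡.refl
  ... | suc k = ≡.refl

  rightFactor≡trail : ∀ n (x : Fin n → Carrier) Y S →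
                      rightFactor R n x Y S ≡ trail (β x Y ⊤) ∣ ∁ S ∣ (β x Y S)
  rightFactor≡trail n x Y S rewrite ∣∁p∣≡n∸∣p∣ S with n ∸ ∣ S ∣
  ... | zero  = ≡.refl
  ... | suc l = ≡.refl

  powerSum-expand : ∀ n (x : Fin (suc n) → Carrier) X Y →
    powerSum (suc n) x X Y
      ≈ leadSum (suc n) x X Y + sum (λ i → x i * powerSum n (removeAt x i) (X + x i) (Y - x i))
  powerSum-expand n x X Y = begin
    powerSum (suc n) x X Y
      ≈⟨ sumSubsets-cong (suc n) split ⟩
    sumSubsets R (suc n) (λ S → abelTerm (lead X) (flip _^_) x X Y S + rest S)
      ≈⟨ sumSubsets-+ (suc n) (abelTerm (lead X) (flip _^_) x X Y) rest ⟩
    leadSum (suc n) x X Y + sumSubsets R (suc n) rest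
      ≈⟨ +-congˡ (abelSum-σ (^-congˡ ∘ pred) ^-congˡ n x X Y) ⟩
    leadSum (suc n) x X Y + sum (λ i → x i * powerSum n (removeAt x i) (X + x i) (Y - x i))
      ∎
    where
    rest : Subset (suc n) → Carrier
    rest S = σ R x S * abelTerm (flip _^_ ∘ pred) (flip _^_) x X Y S

    split : ∀ S → abelTerm (flip _^_) (flip _^_) x X Y S ≈ abelTerm (lead X) (flip _^_) x X Y S + rest S
    split S = trans (*-congʳ (^-split-lead X (σ R x S) (∣ S ∣) (∣S∣≡0⇒σ≈0 x S)))
                    (trans (distribʳ _ _ _) (+-congˡ (*-assoc _ _ _)))

  leadSum-split : ∀ n (x : Fin (suc n) → Carrier) X Y →
    leadSum (suc n) x X Y ≈ lhs R (suc n) x X Y + sum (λ i → leadSum n (removeAt x i) X Y * x i)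
  leadSum-split n x X Y = begin
    leadSum (suc n) x X Y
      ≈⟨ sumSubsets-cong (suc n) split ⟩
    sumSubsets R (suc n) (λ S → leftFactor R x X S * rightFactor R (suc n) x Y S + rest S)
      ≈⟨ sumSubsets-+ (suc n) (λ S → leftFactor R x X S * rightFactor R (suc n) x Y S) rest ⟩
    lhs R (suc n) x X Y + sumSubsets R (suc n) rest
      ≈⟨ +-congˡ (abelSum-σ∁ (lead-cong X) (^-congˡ ∘ pred) n x X Y) ⟩
    lhs R (suc n) x X Y + sum (λ i → leadSum n (removeAt x i) X Y * x i)
      ∎
    where
    rest : Subset (suc n) → Carrier
    rest S = abelTerm (lead X) (flip _^_ ∘ pred) x X Y S * σ R x (∁ S)

    split : ∀ S → abelTerm (lead X) (flip _^_) x X Y S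
                  ≈ leftFactor R x X S * rightFactor R (suc n) x Y S + rest S
    split S = begin
      L * b ^ l
        ≈⟨ *-congˡ (^-split-trail (β x Y ⊤) t l (β≈β⊤+σ∁ x Y S) (∣S∣≡0⇒σ≈0 x (∁ S))) ⟩
      L * (trail (β x Y ⊤) l b + b ^ pred l * t)
        ≈⟨ distribˡ L _ _ ⟩
      L * trail (β x Y ⊤) l b + L * (b ^ pred l * t)
        ≡⟨ ≡.cong₂ (λ u v → u * v + L * (b ^ pred l * t))
                   (leftFactor≡lead x X S) (rightFactor≡trail (suc n) x Y S) ⟨
      leftFactor R x X S * rightFactor R (suc n) x Y S + L * (b ^ pred l * t)
        ≈⟨ +-congˡ (*-assoc L _ _) ⟨
      leftFactor R x X S * rightFactor R (suc n) x Y S + rest S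
        ∎
      where
      L = lead X (∣ S ∣) (α x X S)
      b = β x Y S
      l = ∣ ∁ S ∣
      t = σ R x (∁ S)

  module _ (z : Carrier) (z-central : Central R z) where

    leadSum-peel : ∀ n (x : Fin (suc n) → Carrier) X Y → X + Y ≈ z →
      leadSum (suc n) x X Y + X * powerSum n (removeAt x zero) X Y
        ≈ z * leadSum n (removeAt x zero) X Y + X * powerSum n (removeAt x zero) (X + x zero) (Y - x zero)
    leadSum-peel n x X Y X+Y≈z = begin
      leadSum (suc n) x X Y + X * powerSum n x₀ X Y
        ≈⟨ +-congʳ (abelSum-insertAt (lead-cong X) ^-congˡ n x X Y zero) ⟩
      (A + B) + X * powerSum n x₀ X Y
        ≈⟨ xy∙z≈xz∙y A B _ ⟩
      (A + X * powerSum n x₀ X Y) + B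
        ≈⟨ +-cong first second ⟩
      z * leadSum n x₀ X Y + X * powerSum n x₀ (X + x zero) (Y - x zero)
        ∎
      where
      x₀ = removeAt x zero
      A = abelSum (lead X) (flip _^_ ∘ suc) n x₀ X Y
      B = abelSum (lead X ∘ suc) (flip _^_) n x₀ (X + x zero) (Y - x zero)

      first : A + X * powerSum n x₀ X Y ≈ z * leadSum n x₀ X Y
      first = begin
        A + X * powerSum n x₀ X Y
          ≈⟨ +-congˡ (sumSubsets-*ˡ n X (abelTerm (flip _^_) (flip _^_) x₀ X Y)) ⟨
        A + sumSubsets R n (λ S → X * abelTerm (flip _^_) (flip _^_) x₀ X Y S)
          ≈⟨ sumSubsets-+ n (abelTerm (lead X) (flip _^_ ∘ suc) x₀ X Y)
                            (λ S → X * abelTerm (flip _^_) (flip _^_) x₀ X Y S) ⟨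
        sumSubsets R n (λ S → abelTerm (lead X) (flip _^_ ∘ suc) x₀ X Y S
                              + X * abelTerm (flip _^_) (flip _^_) x₀ X Y S)
          ≈⟨ sumSubsets-cong n (λ S → lead-step z-central X (σ R x₀ S) (∣ S ∣) (∣ ∁ S ∣)
                                        (∣S∣≡0⇒σ≈0 x₀ S) (rebalance (σ R x₀ S) X+Y≈z)) ⟩
        sumSubsets R n (λ S → z * abelTerm (lead X) (flip _^_) x₀ X Y S)
          ≈⟨ sumSubsets-*ˡ n z (abelTerm (lead X) (flip _^_) x₀ X Y) ⟩
        z * leadSum n x₀ X Y
          ∎

      second : B ≈ X * powerSum n x₀ (X + x zero) (Y - x zero)
      second = trans (sumSubsets-cong n (λ S → *-assoc X _ _))
                     (sumSubsets-*ˡ n X (abelTerm (flip _^_) (flip _^_) x₀ (X + x zero) (Y - x zero)))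

    mutual
      leadSum≈^ : ∀ n (x : Fin n → Carrier) X Y → X + Y ≈ z → leadSum n x X Y ≈ z ^ n
      leadSum≈^ zero    x X Y _     = *-identityˡ 1#
      leadSum≈^ (suc n) x X Y X+Y≈z = +-cancelʳ (X * powerSum n x₀ X Y) _ _ (begin
        leadSum (suc n) x X Y + X * powerSum n x₀ X Y
          ≈⟨ leadSum-peel n x X Y X+Y≈z ⟩
        z * leadSum n x₀ X Y + X * powerSum n x₀ (X + x zero) (Y - x zero)
          ≈⟨ +-cong (*-congˡ (leadSum≈^ n x₀ X Y X+Y≈z))
                    (*-congˡ (powerSum-invariant n x₀ (rebalance (x zero) X+Y≈z) X+Y≈z)) ⟩
        z * z ^ n + X * powerSum n x₀ X Y
          ∎)
        where x₀ = removeAt x zero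

      powerSum-invariant : ∀ n (x : Fin n → Carrier) {X Y X′ Y′} → X + Y ≈ z → X′ + Y′ ≈ z →
                           powerSum n x X Y ≈ powerSum n x X′ Y′
      powerSum-invariant zero    x _ _ = refl
      powerSum-invariant (suc n) x {X} {Y} {X′} {Y′} X+Y≈z X′+Y′≈z = begin
        powerSum (suc n) x X Y
          ≈⟨ powerSum-expand n x X Y ⟩
        leadSum (suc n) x X Y + sum (λ i → x i * powerSum n (removeAt x i) (X + x i) (Y - x i))
          ≈⟨ +-cong (trans (leadSum≈^ (suc n) x X Y X+Y≈z) (sym (leadSum≈^ (suc n) x X′ Y′ X′+Y′≈z)))
                    (sum-cong-≋ {suc n} (λ i → *-congˡ {x i} (powerSum-invariant n (removeAt x i)
                      (rebalance (x i) X+Y≈z) (rebalance (x i) X′+Y′≈z)))) ⟩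
        leadSum (suc n) x X′ Y′ + sum (λ i → x i * powerSum n (removeAt x i) (X′ + x i) (Y′ - x i))
          ≈⟨ powerSum-expand n x X′ Y′ ⟨
        powerSum (suc n) x X′ Y′
          ∎

theorem2p6 : {c ℓ : Level} (R : Ring c ℓ) (n : ℕ) (x : Fin n → Ring.Carrier R) (X Y : Ring.Carrier R)
    → Central R (Ring._+_ R X Y)
    → Ring._≈_ R (lhs R n x X Y) (rhs R n x X Y)
theorem2p6 R zero    x X Y _       = Ring.*-identityˡ R (Ring.1# R)
theorem2p6 R (suc n) x X Y central = +-cancelʳ (z ^ n * σ R x ⊤) _ _ (begin
  lhs R (suc n) x X Y + z ^ n * σ R x ⊤
    ≈⟨ +-congˡ (trans (*-congˡ (σ-⊤ x)) (*-distribˡ-sum (z ^ n) x)) ⟩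
  lhs R (suc n) x X Y + sum (λ i → z ^ n * x i)
    ≈⟨ +-congˡ (sum-cong-≋ {suc n} (λ i → *-congʳ {x i} (leadSum≈^ z central n (removeAt x i) X Y refl))) ⟨
  lhs R (suc n) x X Y + sum (λ i → leadSum n (removeAt x i) X Y * x i)
    ≈⟨ leadSum-split n x X Y ⟨
  leadSum (suc n) x X Y
    ≈⟨ leadSum≈^ z central (suc n) x X Y refl ⟩
  z * z ^ n
    ≈⟨ [z-s]w+ws≈zw z (σ R x ⊤) (z ^ n) (sym (^-central central n (σ R x ⊤))) ⟨
  rhs R (suc n) x X Y + z ^ n * σ R x ⊤
    ∎)
  where
  open Ring R hiding (zero)
  open RingProperties R using (+-cancelʳ)
  open ExpProperties semiring using (_^_)
  open SumProperties semiring using (sum; *-distribˡ-sum; sum-cong-≋)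
  open SetoidReasoning setoid
  open AbelIdentity R
  z = X + Y
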